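{- Let $(A,+)$ be a finite cyclic group of order $n$ with generator $\alpha$, $(B,+)$ a finite abelian group, $k\ge2$ an integer, and let $f:A\to B$ be a surjective zero-difference balanced function for which there is $b_0\in B$ with $|f^{ -1}(b_0)|=1$ and $|f^{ -1}(b)|=k$ for all $b\neq b_0$. Let $a_0$ be the element with $f(a_0)=b_0$, let $a\in A$ with $a_0\notin I(a)$, where $I(a)=\{x\in A\mid f(x)=f(a)\}$, and define $g_a(x)=f(x)$ for $x\neq a_0$, $g_a(a_0)=f(a)$. Then $g_a$ is an $(n,\frac{n-1}{k},S)$ zero-difference function for some set $S$; suppose $\max_{x\in S}x=k$. Then the frequency-hopping sequence $\mathcal{T}=(g_a(i\alpha))_{i=0}^{n-1}$ is optimal.
   Context: For $h:A\to B$ with $n=|A|$, $m=|h(A)|$, $\lambda_\beta=|\{x\in A\mid h(x+\beta)=h(x)\}|$ for $\beta\neq 0$: $h$ is an $(n,m,S)$ zero-difference function if $S=\{\lambda_\beta\mid\beta\neq0\}$, and zero-difference balanced if $S$ is a single value. For a sequence $X=(x_i)_{i=0}^{n-1}$, $H_{X,X}(t)=\sum_{i=0}^{n-1}h[x_i,x_{(i+t)\bmod n}]$ with $h[a,b]=1$ if $a=b$ else $0$, and $H(X)=\max_{1\le t<n}H_{X,X}(t)$. A sequence of length $n$ over an alphabet of size $m$ is an optimal frequency-hopping sequence if $H(X)=\lceil\frac{(n-\epsilon)(n+\epsilon-m)}{m(n-1)}\rceil$ (a general lower bound), $\epsilon$ being the least nonnegative residue of $n$ mod $m$. -}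

module Defs where

open import Data.Nat using (ℕ; zero; suc; _+_; _*_; _∸_; _⊔_; NonZero)
open import Data.Nat.DivMod using (_mod_; _/_; _%_)
open import Data.Fin using (Fin; toℕ)
open import Data.List using (List; length; filter; map; foldr; upTo; allFin; deduplicate)
open import Data.Product using (∃)
open import Relation.Binary.PropositionalEquality using (_≡_)
open import Relation.Binary.Definitions using (DecidableEquality)
open import Relation.Nullary using (¬?)
open import Relation.Nullary.Decidable using (does)
open import Data.Bool using (if_then_else_)

-- The cyclic group A of order n is modelled as ℤ/nℤ = Fin n with addition mod n.
module _ (n : ℕ) .{{_ : NonZero n}} where

  _⊕_ : Fin n → Fin n → Fin n
  x ⊕ y = (toℕ x + toℕ y) mod n

  _·_ : ℕ → Fin n → Fin n
  i · x = (i * toℕ x) mod n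

  IsGenerator : Fin n → Set
  IsGenerator α = ∀ (x : Fin n) → ∃ λ (i : ℕ) → i · α ≡ x

  module _ {B : Set} (_≟_ : DecidableEquality B) where

    preimageSize : (Fin n → B) → B → ℕ
    preimageSize h b = length (filter (λ x → h x ≟ b) (allFin n))

    imageSize : (Fin n → B) → ℕ
    imageSize h = length (deduplicate _≟_ (map h (allFin n)))

    lam : (Fin n → B) → Fin n → ℕ
    lam h β = length (filter (λ x → h (x ⊕ β) ≟ h x) (allFin n))

    nonzeros : List (Fin n)
    nonzeros = filter (λ β → ¬? (toℕ β Data.Nat.≟ 0)) (allFin n)

    -- max S, where S = {λ_β | β ≠ 0}
    maxLam : (Fin n → B) → ℕ
    maxLam h = foldr _⊔_ 0 (map (lam h) nonzeros)

    IsZDB : (Fin n → B) → Set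
    IsZDB h = ∃ λ (c : ℕ) → ∀ (β : Fin n) → ¬ (toℕ β ≡ 0) → lam h β ≡ c
      where open import Relation.Nullary using (¬_)

    redefineAt : (Fin n → B) → Fin n → Fin n → (Fin n → B)
    redefineAt f a0 a x = if does (x Data.Fin.≟ a0) then f a else f x

    hammingAuto : (ℕ → B) → ℕ → ℕ
    hammingAuto X t = length (filter (λ i → X i ≟ X ((i + t) % n)) (upTo n))

    hammingMax : (ℕ → B) → ℕ
    hammingMax X = foldr _⊔_ 0 (map (hammingAuto X) (map suc (upTo (n ∸ 1))))

-- ⌈a / b⌉ for b > 0 (value at b = 0 is an irrelevant convention)
ceilDiv : ℕ → ℕ → ℕ
ceilDiv a zero = 0
ceilDiv a (suc b) = (a + b) / suc b

-- n mod m, least nonnegative residue (value at m = 0 is an irrelevant convention)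
modN : ℕ → ℕ → ℕ
modN a zero = a
modN a (suc m) = a % suc m

-- the lower bound ⌈(n-ε)(n+ε-m) / (m(n-1))⌉ with ε = n mod m
fhsBound : ℕ → ℕ → ℕ
fhsBound n m = ceilDiv ((n ∸ ε) * (n + ε ∸ m)) (m * (n ∸ 1))
  where ε = modN n m

-- Redefining f at a₀ merges the singleton fibre of b₀ into the fibre of f(a), so g_a has fibres
-- of size k over all but one of its m values and of size k + 1 over f(a); hence n = m k + 1.
-- Multiplication by the generator α is a bijection {0,…,n−1} → ℤ/nℤ turning the shift t into the
-- difference tα, so the autocorrelation of the sequence at t is λ_{tα}(g_a) and H equals max S = k.
-- For n = m k + 1 with m ≥ 2 (m = 1 would force λ_β = n = k + 1) the bound is ⌈k − 1 + 2/m⌉ = k.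
module Submission where

open import Defs
open import Data.Nat using (ℕ; suc; _+_; _*_; _∸_; _⊔_; _≤_; _<_; z≤n; s≤s; NonZero; >-nonZero⁻¹)
  renaming (_≟_ to _≟ⁿ_)
open import Data.Fin using (Fin; toℕ) renaming (_≟_ to _≟ᶠ_)
open import Data.Product using (∃; _×_; _,_; proj₁; proj₂)
open import Relation.Binary.PropositionalEquality
  using (_≡_; refl; sym; trans; cong; cong₂; subst; module ≡-Reasoning)
open import Relation.Binary.Definitions using (DecidableEquality)
open import Relation.Nullary using (¬_; Dec; yes; no; does; ¬?; contradiction)

open import Data.Bool using (if_then_else_)
open import Data.Fin.Properties using (toℕ-fromℕ<; toℕ-injective)
open import Data.List using (List; []; _∷_; length; filter; map; foldr; upTo; allFin; deduplicate)
open import Data.List.Properties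
  using (filter-≐; filter-none; filter-all; map-cong; map-cong-local; map-upTo; length-tabulate)
open import Data.List.Membership.Propositional using (_∈_)
open import Data.List.Membership.Propositional.Properties
  using (∈-filter⁺; ∈-filter⁻; ∈-allFin; ∈-map⁺; ∈-map⁻; ∈-upTo⁺; ∈-upTo⁻;
         ∈-deduplicate⁺; ∈-deduplicate⁻; ∈-length)
open import Data.List.Membership.Propositional.Properties.WithK using (unique∧set⇒bag)
open import Data.List.Relation.Binary.BagAndSetEquality using (∼bag⇒↭)
open import Data.List.Relation.Binary.Permutation.Propositional using (_↭_)
open import Data.List.Relation.Binary.Permutation.Propositional.Properties using (filter-↭; ↭-length)
open import Data.List.Relation.Unary.All as All using (All)
open import Data.List.Relation.Unary.AllPairs using (_∷_)
open import Data.List.Relation.Unary.Any using (here; there)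
open import Data.List.Relation.Unary.Unique.Propositional using (Unique)
open import Data.List.Relation.Unary.Unique.Propositional.Properties using (applyUpTo⁺₁; allFin⁺)
open import Data.List.Relation.Unary.Unique.DecPropositional.Properties using (deduplicate-!)
open import Data.Nat.DivMod
  using (_%_; _/_; _mod_; %-distribˡ-*; %-distribˡ-+; m%n%n≡m%n; m<n⇒m%n≡m; m%n<n; [m+kn]%n≡m%n;
         +-distrib-/-∣ʳ; m<n⇒m/n≡0; m*n/n≡m)
open import Data.Nat.Divisibility using (divides-refl)
open import Data.Nat.ListAction using (sum)
open import Data.Nat.Properties
open import Algebra.Properties.CommutativeSemigroup +-commutativeSemigroup using (interchange)
open import Data.Nat.Tactic.RingSolver using (solve-∀)
open import Data.Sum using (_⊎_; inj₁; inj₂)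
open import Function using (_∘_; mk⇔)
open import Level using (0ℓ)
open import Relation.Unary using (Pred; Decidable; _≐_; _∪_; _∩_; Empty)

𝟙 : {P : Set} → Dec P → ℕ
𝟙 P? = if does P? then 1 else 0

count : {A : Set} {P : Pred A 0ℓ} → Decidable P → List A → ℕ
count P? xs = length (filter P? xs)

sum-map-+ : {A : Set} (f g : A → ℕ) (xs : List A) →
            sum (map (λ x → f x + g x) xs) ≡ sum (map f xs) + sum (map g xs)
sum-map-+ f g [] = refl
sum-map-+ f g (x ∷ xs) = trans (cong (f x + g x +_) (sum-map-+ f g xs))
                               (interchange (f x) (g x) (sum (map f xs)) (sum (map g xs)))

sum-map-const : {A : Set} (c : ℕ) (xs : List A) → sum (map (λ _ → c) xs) ≡ length xs * c
sum-map-const c [] = refl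
sum-map-const c (x ∷ xs) = cong (c +_) (sum-map-const c xs)

length≡1⇒∈-unique : {A : Set} {xs : List A} {x y : A} → length xs ≡ 1 → x ∈ xs → y ∈ xs → x ≡ y
length≡1⇒∈-unique {xs = _ ∷ []} _ (here refl) (here refl) = refl

module _ {A : Set} {P : Pred A 0ℓ} (P? : Decidable P) where

  count-∷ : ∀ x xs → count P? (x ∷ xs) ≡ 𝟙 (P? x) + count P? xs
  count-∷ x xs with P? x
  ... | yes _ = refl
  ... | no _ = refl

  sum-map-𝟙 : ∀ xs → sum (map (λ x → 𝟙 (P? x)) xs) ≡ count P? xs
  sum-map-𝟙 [] = refl
  sum-map-𝟙 (x ∷ xs) = trans (cong (𝟙 (P? x) +_) (sum-map-𝟙 xs)) (sym (count-∷ x xs))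

  count-↭ : {xs ys : List A} → xs ↭ ys → count P? xs ≡ count P? ys
  count-↭ xs↭ys = ↭-length (filter-↭ P? xs↭ys)

  count≡1⇒unique : ∀ {xs x y} → count P? xs ≡ 1 → x ∈ xs → y ∈ xs → P x → P y → x ≡ y
  count≡1⇒unique c x∈ y∈ px py = length≡1⇒∈-unique c (∈-filter⁺ P? x∈ px) (∈-filter⁺ P? y∈ py)

  count-unique : ∀ {xs x} → Unique xs → x ∈ xs → P x → (∀ {y} → P y → y ≡ x) → count P? xs ≡ 1
  count-unique {y ∷ ys} (y∉ys ∷ _) (here refl) px only with P? y
  ... | yes _ = cong suc (cong length (filter-none P? (All.map (λ y≢z pz → y≢z (sym (only pz))) y∉ys)))
  ... | no ¬py = contradiction px ¬py
  count-unique {y ∷ ys} (y∉ys ∷ ys!) (there x∈ys) px only with P? y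
  ... | yes py = contradiction (only py) (All.lookup y∉ys x∈ys)
  ... | no _ = count-unique ys! x∈ys px only

count-map : {A C : Set} {P : Pred A 0ℓ} (P? : Decidable P) (f : C → A) (xs : List C) →
            count P? (map f xs) ≡ count (λ x → P? (f x)) xs
count-map P? f [] = refl
count-map P? f (x ∷ xs) = trans (count-∷ P? (f x) (map f xs))
                                (trans (cong (𝟙 (P? (f x)) +_) (count-map P? f xs)) (sym (count-∷ _ x xs)))

count-≐ : {A : Set} {P Q : Pred A 0ℓ} (P? : Decidable P) (Q? : Decidable Q) → P ≐ Q →
          ∀ xs → count P? xs ≡ count Q? xs
count-≐ P? Q? P≐Q xs = cong length (filter-≐ P? Q? P≐Q xs)

module _ {A : Set} {P Q R : Pred A 0ℓ} (P? : Decidable P) (Q? : Decidable Q) (R? : Decidable R) where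

  count-∪ : P ≐ Q ∪ R → Empty (Q ∩ R) → ∀ xs → count P? xs ≡ count Q? xs + count R? xs
  count-∪ P≐Q∪R Q∩R=∅ [] = refl
  count-∪ P≐Q∪R@(split , join) Q∩R=∅ (x ∷ xs) = begin
    count P? (x ∷ xs)
      ≡⟨ count-∷ P? x xs ⟩
    𝟙 (P? x) + count P? xs
      ≡⟨ cong₂ _+_ 𝟙-split (count-∪ P≐Q∪R Q∩R=∅ xs) ⟩
    (𝟙 (Q? x) + 𝟙 (R? x)) + (count Q? xs + count R? xs)
      ≡⟨ interchange (𝟙 (Q? x)) (𝟙 (R? x)) (count Q? xs) (count R? xs) ⟩
    (𝟙 (Q? x) + count Q? xs) + (𝟙 (R? x) + count R? xs)
      ≡⟨ cong₂ _+_ (count-∷ Q? x xs) (count-∷ R? x xs) ⟨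
    count Q? (x ∷ xs) + count R? (x ∷ xs) ∎
    where
    open ≡-Reasoning
    𝟙-split : 𝟙 (P? x) ≡ 𝟙 (Q? x) + 𝟙 (R? x)
    𝟙-split with P? x | Q? x | R? x
    ... | _     | yes q | yes r = contradiction (q , r) (Q∩R=∅ x)
    ... | yes _ | yes _ | no _  = refl
    ... | yes _ | no _  | yes _ = refl
    ... | yes p | no ¬q | no ¬r with split p
    ...   | inj₁ q = contradiction q ¬q
    ...   | inj₂ r = contradiction r ¬r
    𝟙-split | no ¬p | yes q | no _  = contradiction (join (inj₁ q)) ¬p
    𝟙-split | no ¬p | no _  | yes r = contradiction (join (inj₂ r)) ¬p
    𝟙-split | no _  | no _  | no _  = refl

module _ {A B : Set} (_≟_ : DecidableEquality B) (h : A → B) {ys : List B}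
         (ys! : Unique ys) (h∈ys : ∀ x → h x ∈ ys) where

  sum-fibres : ∀ xs → sum (map (λ b → count (λ x → h x ≟ b) xs) ys) ≡ length xs
  sum-fibres [] = trans (sum-map-const 0 ys) (*-zeroʳ (length ys))
  sum-fibres (x ∷ xs) = begin
    sum (map (λ b → count (λ z → h z ≟ b) (x ∷ xs)) ys)
      ≡⟨ cong sum (map-cong (λ b → count-∷ (λ z → h z ≟ b) x xs) ys) ⟩
    sum (map (λ b → 𝟙 (h x ≟ b) + count (λ z → h z ≟ b) xs) ys)
      ≡⟨ sum-map-+ (λ b → 𝟙 (h x ≟ b)) (λ b → count (λ z → h z ≟ b) xs) ys ⟩
    sum (map (λ b → 𝟙 (h x ≟ b)) ys) + sum (map (λ b → count (λ z → h z ≟ b) xs) ys)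
      ≡⟨ cong₂ _+_ (trans (sum-map-𝟙 (h x ≟_) ys) (count-unique (h x ≟_) ys! (h∈ys x) refl sym))
                   (sum-fibres xs) ⟩
    1 + length xs ∎
    where open ≡-Reasoning

maxOf : {A : Set} → (A → ℕ) → List A → ℕ
maxOf h xs = foldr _⊔_ 0 (map h xs)

module _ {A : Set} (h : A → ℕ) where

  ≤-maxOf : ∀ {x xs} → x ∈ xs → h x ≤ maxOf h xs
  ≤-maxOf {xs = y ∷ ys} (here refl) = m≤m⊔n (h y) (maxOf h ys)
  ≤-maxOf {xs = y ∷ ys} (there x∈ys) = ≤-trans (≤-maxOf x∈ys) (m≤n⊔m (h y) (maxOf h ys))

  maxOf-≤ : ∀ {c} xs → (∀ {x} → x ∈ xs → h x ≤ c) → maxOf h xs ≤ c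
  maxOf-≤ [] _ = z≤n
  maxOf-≤ (x ∷ xs) bound = ⊔-lub (bound (here refl)) (maxOf-≤ xs (λ x∈xs → bound (there x∈xs)))

  maxOf-attained : ∀ xs → 0 < maxOf h xs → ∃ λ x → x ∈ xs × h x ≡ maxOf h xs
  maxOf-attained (x ∷ xs) 0<max with ⊔-sel (h x) (maxOf h xs)
  ... | inj₁ max≡hx = x , here refl , sym max≡hx
  ... | inj₂ max≡rest with y , y∈xs , hy≡ ← maxOf-attained xs (subst (0 <_) max≡rest 0<max) =
    y , there y∈xs , trans hy≡ (sym max≡rest)

*-%-absorbʳ : ∀ m n d .{{_ : NonZero d}} → (m * (n % d)) % d ≡ (m * n) % d
*-%-absorbʳ m n d = begin
  (m * (n % d)) % d            ≡⟨ %-distribˡ-* m (n % d) d ⟩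
  (m % d * (n % d % d)) % d    ≡⟨ cong (λ r → (m % d * r) % d) (m%n%n≡m%n n d) ⟩
  (m % d * (n % d)) % d        ≡⟨ %-distribˡ-* m n d ⟨
  (m * n) % d                  ∎
  where open ≡-Reasoning

module _ (n : ℕ) .{{_ : NonZero n}} where

  private
    _⊕ₙ_ : Fin n → Fin n → Fin n
    _⊕ₙ_ = _⊕_ n
    _·ₙ_ : ℕ → Fin n → Fin n
    _·ₙ_ = _·_ n

  toℕ-mod : ∀ m → toℕ (m mod n) ≡ m % n
  toℕ-mod m = toℕ-fromℕ< _

  ·-mod : ∀ i x → (i % n) ·ₙ x ≡ i ·ₙ x
  ·-mod i x = toℕ-injective (begin
    toℕ ((i % n) ·ₙ x)       ≡⟨ toℕ-mod _ ⟩
    (i % n * toℕ x) % n     ≡⟨ cong (_% n) (*-comm (i % n) (toℕ x)) ⟩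
    (toℕ x * (i % n)) % n   ≡⟨ *-%-absorbʳ (toℕ x) i n ⟩
    (toℕ x * i) % n         ≡⟨ cong (_% n) (*-comm (toℕ x) i) ⟩
    (i * toℕ x) % n         ≡⟨ toℕ-mod _ ⟨
    toℕ (i ·ₙ x)             ∎)
    where open ≡-Reasoning

  ·-distribʳ-+ : ∀ i j x → (i + j) ·ₙ x ≡ (i ·ₙ x) ⊕ₙ (j ·ₙ x)
  ·-distribʳ-+ i j x = toℕ-injective (begin
    toℕ ((i + j) ·ₙ x)                        ≡⟨ toℕ-mod _ ⟩
    ((i + j) * toℕ x) % n                    ≡⟨ cong (_% n) (*-distribʳ-+ (toℕ x) i j) ⟩
    (i * toℕ x + j * toℕ x) % n              ≡⟨ %-distribˡ-+ (i * toℕ x) (j * toℕ x) n ⟩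
    ((i * toℕ x) % n + (j * toℕ x) % n) % n  ≡⟨ cong₂ (λ u v → (u + v) % n) (toℕ-mod _) (toℕ-mod _) ⟨
    (toℕ (i ·ₙ x) + toℕ (j ·ₙ x)) % n          ≡⟨ toℕ-mod _ ⟨
    toℕ ((i ·ₙ x) ⊕ₙ (j ·ₙ x))                 ∎)
    where open ≡-Reasoning

  ·-assoc : ∀ i j x → i ·ₙ (j ·ₙ x) ≡ (i * j) ·ₙ x
  ·-assoc i j x = toℕ-injective (begin
    toℕ (i ·ₙ (j ·ₙ x))          ≡⟨ toℕ-mod _ ⟩
    (i * toℕ (j ·ₙ x)) % n       ≡⟨ cong (λ r → (i * r) % n) (toℕ-mod _) ⟩
    (i * ((j * toℕ x) % n)) % n ≡⟨ *-%-absorbʳ i (j * toℕ x) n ⟩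
    (i * (j * toℕ x)) % n       ≡⟨ cong (_% n) (*-assoc i j (toℕ x)) ⟨
    (i * j * toℕ x) % n         ≡⟨ toℕ-mod _ ⟨
    toℕ ((i * j) ·ₙ x)           ∎)
    where open ≡-Reasoning

  ·-injective-on-generator : ∀ {α} → IsGenerator n α → ∀ {i j} → i < n → j < n → i ·ₙ α ≡ j ·ₙ α → i ≡ j
  ·-injective-on-generator {α} gen {i} {j} i<n j<n iα≡jα = begin
    i                     ≡⟨ m<n⇒m%n≡m i<n ⟨
    i % n                 ≡⟨ undo-α i ⟨
    toℕ (u ·ₙ (i ·ₙ α))   ≡⟨ cong (λ y → toℕ (u ·ₙ y)) iα≡jα ⟩
    toℕ (u ·ₙ (j ·ₙ α))   ≡⟨ undo-α j ⟩
    j % n                 ≡⟨ m<n⇒m%n≡m j<n ⟩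
    j                     ∎
    where
    open ≡-Reasoning
    -- u is an inverse of α: u α = 1, so multiplying by u recovers i mod n from i α.
    u : ℕ
    u = proj₁ (gen (1 mod n))
    undo-α : ∀ i → toℕ (u ·ₙ (i ·ₙ α)) ≡ i % n
    undo-α i = begin
      toℕ (u ·ₙ (i ·ₙ α))      ≡⟨ cong toℕ (trans (·-assoc u i α) (cong (_·ₙ α) (*-comm u i))) ⟩
      toℕ ((i * u) ·ₙ α)       ≡⟨ cong toℕ (·-assoc i u α) ⟨
      toℕ (i ·ₙ (u ·ₙ α))      ≡⟨ cong (λ y → toℕ (i ·ₙ y)) (proj₂ (gen (1 mod n))) ⟩
      toℕ (i ·ₙ (1 mod n))     ≡⟨ toℕ-mod _ ⟩
      (i * toℕ (1 mod n)) % n ≡⟨ cong (λ r → (i * r) % n) (toℕ-mod 1) ⟩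
      (i * (1 % n)) % n       ≡⟨ *-%-absorbʳ i 1 n ⟩
      (i * 1) % n             ≡⟨ cong (_% n) (*-identityʳ i) ⟩
      i % n                   ∎

  toℕ-0· : ∀ x → toℕ (0 ·ₙ x) ≡ 0
  toℕ-0· x = trans (toℕ-mod 0) (m<n⇒m%n≡m (>-nonZero⁻¹ n))

  module _ {α : Fin n} (gen : IsGenerator n α) where

    multiples↭allFin : map (_·ₙ α) (upTo n) ↭ allFin n
    multiples↭allFin = ∼bag⇒↭ (unique∧set⇒bag multiples! (allFin⁺ n) (mk⇔ (λ _ → ∈-allFin _) multiple))
      where
      multiples! : Unique (map (_·ₙ α) (upTo n))
      multiples! = subst Unique (sym (map-upTo (_·ₙ α) n))
        (applyUpTo⁺₁ (_·ₙ α) n (λ i<j j<n → <⇒≢ i<j ∘ ·-injective-on-generator gen (<-trans i<j j<n) j<n))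
      multiple : ∀ {y} → y ∈ allFin n → y ∈ map (_·ₙ α) (upTo n)
      multiple {y} _ with i , iα≡y ← gen y =
        subst (_∈ _) (trans (·-mod i α) iα≡y) (∈-map⁺ (_·ₙ α) (∈-upTo⁺ (m%n<n i n)))

    hammingAuto≡lam : {B : Set} (_≟_ : DecidableEquality B) (g : Fin n → B) →
                      ∀ t → hammingAuto n _≟_ (λ i → g (i ·ₙ α)) t ≡ lam n _≟_ g (t ·ₙ α)
    hammingAuto≡lam _≟_ g t = begin
      count (λ i → g (i ·ₙ α) ≟ g (((i + t) % n) ·ₙ α)) (upTo n)
        ≡⟨ count-≐ _ _ ((λ {i} p → trans p (cong g (shift i))) , (λ {i} q → trans q (cong g (sym (shift i)))))
                   (upTo n) ⟩
      count (λ i → g (i ·ₙ α) ≟ g ((i ·ₙ α) ⊕ₙ (t ·ₙ α))) (upTo n)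
        ≡⟨ count-map (λ y → g y ≟ g (y ⊕ₙ (t ·ₙ α))) (_·ₙ α) (upTo n) ⟨
      count (λ y → g y ≟ g (y ⊕ₙ (t ·ₙ α))) (map (_·ₙ α) (upTo n))
        ≡⟨ count-↭ (λ y → g y ≟ g (y ⊕ₙ (t ·ₙ α))) multiples↭allFin ⟩
      count (λ y → g y ≟ g (y ⊕ₙ (t ·ₙ α))) (allFin n)
        ≡⟨ count-≐ _ _ (sym , sym) (allFin n) ⟩
      count (λ y → g (y ⊕ₙ (t ·ₙ α)) ≟ g y) (allFin n) ∎
      where
      open ≡-Reasoning
      shift : ∀ i → ((i + t) % n) ·ₙ α ≡ (i ·ₙ α) ⊕ₙ (t ·ₙ α)
      shift i = trans (·-mod (i + t) α) (·-distribʳ-+ i t α)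

module _ (n : ℕ) .{{_ : NonZero n}} {B : Set} (_≟_ : DecidableEquality B) where

  image : (Fin n → B) → List B
  image h = deduplicate _≟_ (map h (allFin n))

  module _ (h : Fin n → B) where

    image! : Unique (image h)
    image! = deduplicate-! _≟_ (map h (allFin n))

    ∈-image⁺ : ∀ x → h x ∈ image h
    ∈-image⁺ x = ∈-deduplicate⁺ _≟_ (∈-map⁺ h (∈-allFin x))

    ∈-image⁻ : ∀ {b} → b ∈ image h → ∃ λ x → b ≡ h x
    ∈-image⁻ b∈ with x , _ , b≡hx ← ∈-map⁻ h (∈-deduplicate⁻ _≟_ (map h (allFin n)) b∈) = x , b≡hx

    sum-preimageSize : sum (map (preimageSize n _≟_ h) (image h)) ≡ n
    sum-preimageSize = trans (sum-fibres _≟_ h image! ∈-image⁺ (allFin n)) (length-tabulate (λ x → x))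

  module _ (h : Fin n → B) (x₀ x₁ : Fin n) where

    private
      g : Fin n → B
      g = redefineAt n _≟_ h x₀ x₁

    redefineAt-at : g x₀ ≡ h x₁
    redefineAt-at with x₀ ≟ᶠ x₀
    ... | yes _ = refl
    ... | no x₀≢x₀ = contradiction refl x₀≢x₀

    preimageSize-redefineAt : ∀ {b} → ¬ h x₀ ≡ b →
      preimageSize n _≟_ g b ≡ 𝟙 (h x₁ ≟ b) + preimageSize n _≟_ h b
    preimageSize-redefineAt {b} hx₀≢b with h x₁ ≟ b
    ... | yes hx₁≡b = begin
      count (λ x → g x ≟ b) (allFin n)
        ≡⟨ count-∪ (λ x → g x ≟ b) (_≟ᶠ x₀) (λ x → h x ≟ b) (split , join) disjoint (allFin n) ⟩
      count (_≟ᶠ x₀) (allFin n) + preimageSize n _≟_ h b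
        ≡⟨ cong (_+ preimageSize n _≟_ h b)
                (count-unique (_≟ᶠ x₀) (allFin⁺ n) (∈-allFin x₀) refl (λ x≡x₀ → x≡x₀)) ⟩
      1 + preimageSize n _≟_ h b ∎
      where
      open ≡-Reasoning
      split : ∀ {x} → g x ≡ b → x ≡ x₀ ⊎ h x ≡ b
      split {x} gx≡b with x ≟ᶠ x₀
      ... | yes x≡x₀ = inj₁ x≡x₀
      ... | no _ = inj₂ gx≡b
      join : ∀ {x} → x ≡ x₀ ⊎ h x ≡ b → g x ≡ b
      join (inj₁ refl) = trans redefineAt-at hx₁≡b
      join {x} (inj₂ hx≡b) with x ≟ᶠ x₀
      ... | yes refl = contradiction hx≡b hx₀≢b
      ... | no _ = hx≡b
      disjoint : ∀ x → ¬ (x ≡ x₀ × h x ≡ b)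
      disjoint x (refl , hx≡b) = hx₀≢b hx≡b
    ... | no hx₁≢b = count-≐ (λ x → g x ≟ b) (λ x → h x ≟ b) (to , from) (allFin n)
      where
      to : ∀ {x} → g x ≡ b → h x ≡ b
      to {x} gx≡b with x ≟ᶠ x₀
      ... | yes _ = contradiction gx≡b hx₁≢b
      ... | no _ = gx≡b
      from : ∀ {x} → h x ≡ b → g x ≡ b
      from {x} hx≡b with x ≟ᶠ x₀
      ... | yes refl = contradiction hx≡b hx₀≢b
      ... | no _ = hx≡b

ceilDiv-unique : ∀ {a q s} D → 0 < s → s ≤ D → a + D ≡ s + q * D → ceilDiv a D ≡ q
ceilDiv-unique {a} {q} {suc r} (suc d) _ s≤D a+D≡s+qD = begin
  (a + d) / suc d                   ≡⟨ cong (_/ suc d) a+d≡r+qD ⟩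
  (r + q * suc d) / suc d           ≡⟨ +-distrib-/-∣ʳ r (divides-refl q) ⟩
  r / suc d + q * suc d / suc d     ≡⟨ cong₂ _+_ (m<n⇒m/n≡0 s≤D) (m*n/n≡m q (suc d)) ⟩
  q                                 ∎
  where
  open ≡-Reasoning
  a+d≡r+qD : a + d ≡ r + q * suc d
  a+d≡r+qD = suc-injective (trans (sym (+-suc a d)) a+D≡s+qD)

-- For n = m k + 1 we have ε = 1, and the ceiling is read off from
-- m k (m k + 2 − m) + m · m k = 2 m k + k · (m · m k) with 0 < 2 m k ≤ m · m k.
fhsBound-one-more : ∀ m k → 2 ≤ m → 1 ≤ k → fhsBound (suc (m * k)) m ≡ k
fhsBound-one-more m@(suc (suc p)) k@(suc q) 2≤m _ = begin
  fhsBound (suc (m * k)) m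
    ≡⟨ cong (λ ε → ceilDiv ((suc (m * k) ∸ ε) * (suc (m * k) + ε ∸ m)) (m * (m * k))) ε≡1 ⟩
  ceilDiv (m * k * (suc (m * k) + 1 ∸ m)) (m * (m * k))
    ≡⟨ cong (λ c → ceilDiv (m * k * c) (m * (m * k)))
            (trans (cong (_∸ m) (n+1≡mq+2+m p q)) (m+n∸n≡m (m * q + 2) m)) ⟩
  ceilDiv (m * k * (m * q + 2)) (m * (m * k))
    ≡⟨ ceilDiv-unique (m * (m * k)) (s≤s z≤n) (*-monoˡ-≤ (m * k) 2≤m) (numerator+D≡2mk+kD p q) ⟩
  k ∎
  where
  open ≡-Reasoning
  ε≡1 : suc (m * k) % m ≡ 1
  ε≡1 = begin
    (1 + m * k) % m  ≡⟨ cong (λ x → (1 + x) % m) (*-comm m k) ⟩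
    (1 + k * m) % m  ≡⟨ [m+kn]%n≡m%n 1 k m ⟩
    1 % m            ≡⟨ m<n⇒m%n≡m 2≤m ⟩
    1                ∎
  n+1≡mq+2+m : ∀ p q → let m = suc (suc p) in suc (m * suc q) + 1 ≡ m * q + 2 + m
  n+1≡mq+2+m = solve-∀
  numerator+D≡2mk+kD : ∀ p q → let m = suc (suc p); k = suc q in
                       m * k * (m * q + 2) + m * (m * k) ≡ 2 * (m * k) + k * (m * (m * k))
  numerator+D≡2mk+kD = solve-∀
fhsBound-one-more 1 _ (s≤s ()) _

positives : ℕ → List ℕ
positives n = map suc (upTo (n ∸ 1))

∈-positives⁺ : ∀ {n t} → 0 < t → t < n → t ∈ positives n
∈-positives⁺ {suc n} {suc t} _ (s≤s t<n) = ∈-map⁺ suc (∈-upTo⁺ t<n)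

∈-positives⁻ : ∀ {n t} → t ∈ positives n → 0 < t × t < n
∈-positives⁻ {suc n} t∈ with i , i∈ , refl ← ∈-map⁻ suc t∈ = s≤s z≤n , s≤s (∈-upTo⁻ i∈)

module _ (n : ℕ) .{{_ : NonZero n}} {B : Set} (_≟_ : DecidableEquality B) where

  ∈-nonzeros⁺ : ∀ {β} → ¬ toℕ β ≡ 0 → β ∈ nonzeros n _≟_
  ∈-nonzeros⁺ = ∈-filter⁺ (λ β → ¬? (toℕ β ≟ⁿ 0)) (∈-allFin _)

  ∈-nonzeros⁻ : ∀ {β} → β ∈ nonzeros n _≟_ → ¬ toℕ β ≡ 0
  ∈-nonzeros⁻ β∈ = proj₂ (∈-filter⁻ (λ β → ¬? (toℕ β ≟ⁿ 0)) {xs = allFin n} β∈)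

module Redefined (n : ℕ) .{{_ : NonZero n}} {B : Set} (_≟_ : DecidableEquality B) (k : ℕ) (f : Fin n → B)
         (b₀ : B) (f⁻¹b₀ : preimageSize n _≟_ f b₀ ≡ 1) (f⁻¹b : ∀ b → ¬ b ≡ b₀ → preimageSize n _≟_ f b ≡ k)
         (a₀ : Fin n) (fa₀≡b₀ : f a₀ ≡ b₀) (a : Fin n) (fa₀≢fa : ¬ f a₀ ≡ f a) where

  private
    g : Fin n → B
    g = redefineAt n _≟_ f a₀ a

  only-a₀-hits-b₀ : ∀ {x} → f x ≡ b₀ → x ≡ a₀
  only-a₀-hits-b₀ fx≡b₀ = count≡1⇒unique (λ x → f x ≟ b₀) f⁻¹b₀ (∈-allFin _) (∈-allFin _) fx≡b₀ fa₀≡b₀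

  redefineAt-avoids-b₀ : ∀ x → ¬ g x ≡ b₀
  redefineAt-avoids-b₀ x with x ≟ᶠ a₀
  ... | yes _ = λ fa≡b₀ → fa₀≢fa (trans fa₀≡b₀ (sym fa≡b₀))
  ... | no x≢a₀ = λ fx≡b₀ → x≢a₀ (only-a₀-hits-b₀ fx≡b₀)

  preimageSize-redefined : ∀ {b} → b ∈ image n _≟_ g → preimageSize n _≟_ g b ≡ 𝟙 (f a ≟ b) + k
  preimageSize-redefined b∈ with x , refl ← ∈-image⁻ n _≟_ g b∈ = begin
    preimageSize n _≟_ g (g x)                     ≡⟨ preimageSize-redefineAt n _≟_ f a₀ a fa₀≢gx ⟩
    𝟙 (f a ≟ g x) + preimageSize n _≟_ f (g x)     ≡⟨ cong (𝟙 (f a ≟ g x) +_) (f⁻¹b (g x) (redefineAt-avoids-b₀ x)) ⟩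
    𝟙 (f a ≟ g x) + k                              ∎
    where
    open ≡-Reasoning
    fa₀≢gx : ¬ f a₀ ≡ g x
    fa₀≢gx fa₀≡gx = redefineAt-avoids-b₀ x (trans (sym fa₀≡gx) fa₀≡b₀)

  imageSize-redefined : suc (imageSize n _≟_ g * k) ≡ n
  imageSize-redefined = begin
    1 + length ys * k
      ≡⟨ cong₂ _+_ fa-once (sum-map-const k ys) ⟨
    count (f a ≟_) ys + sum (map (λ _ → k) ys)
      ≡⟨ cong (_+ sum (map (λ _ → k) ys)) (sum-map-𝟙 (f a ≟_) ys) ⟨
    sum (map (λ b → 𝟙 (f a ≟ b)) ys) + sum (map (λ _ → k) ys)
      ≡⟨ sum-map-+ (λ b → 𝟙 (f a ≟ b)) (λ _ → k) ys ⟨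
    sum (map (λ b → 𝟙 (f a ≟ b) + k) ys)
      ≡⟨ cong sum (map-cong-local (All.tabulate preimageSize-redefined)) ⟨
    sum (map (preimageSize n _≟_ g) ys)
      ≡⟨ sum-preimageSize n _≟_ g ⟩
    n ∎
    where
    open ≡-Reasoning
    ys : List B
    ys = image n _≟_ g
    fa-once : count (f a ≟_) ys ≡ 1
    fa-once = count-unique (f a ≟_) (image! n _≟_ g)
                (subst (_∈ ys) (redefineAt-at n _≟_ f a₀ a) (∈-image⁺ n _≟_ g a₀)) refl sym

  module _ {α : Fin n} (gen : IsGenerator n α) (0<k : 0 < k) (maxλ≡k : maxLam n _≟_ g ≡ k) where

    private
      T : ℕ → B
      T i = g (_·_ n i α)

    maximising-difference : ∃ λ β → β ∈ nonzeros n _≟_ × lam n _≟_ g β ≡ k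
    maximising-difference
      with β , β∈ , λβ≡max ← maxOf-attained (lam n _≟_ g) (nonzeros n _≟_) (subst (0 <_) (sym maxλ≡k) 0<k)
      = β , β∈ , trans λβ≡max maxλ≡k

    2≤imageSize : 2 ≤ imageSize n _≟_ g
    2≤imageSize = ≤∧≢⇒< (∈-length (∈-image⁺ n _≟_ g a₀)) 1≢imageSize
      where
      1≢imageSize : ¬ 1 ≡ imageSize n _≟_ g
      1≢imageSize 1≡m with β , _ , λβ≡k ← maximising-difference = 1+n≢n (begin
        suc k                         ≡⟨ cong suc (*-identityˡ k) ⟨
        suc (1 * k)                   ≡⟨ cong (λ m → suc (m * k)) 1≡m ⟩
        suc (imageSize n _≟_ g * k)   ≡⟨ imageSize-redefined ⟩
        n                             ≡⟨ length-tabulate (λ x → x) ⟨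
        length (allFin n)             ≡⟨ cong length (filter-all (λ x → g (_⊕_ n x β) ≟ g x) {xs = allFin n}
                                                                 (All.tabulate (λ _ → constant))) ⟨
        lam n _≟_ g β                 ≡⟨ λβ≡k ⟩
        k                             ∎)
        where
        open ≡-Reasoning
        constant : ∀ {x y} → g x ≡ g y
        constant = length≡1⇒∈-unique (sym 1≡m) (∈-image⁺ n _≟_ g _) (∈-image⁺ n _≟_ g _)

    hammingMax≤k : hammingMax n _≟_ T ≤ k
    hammingMax≤k = maxOf-≤ (hammingAuto n _≟_ T) (positives n) bound
      where
      bound : ∀ {t} → t ∈ positives n → hammingAuto n _≟_ T t ≤ k
      bound {t} t∈ with 0<t , t<n ← ∈-positives⁻ t∈ = begin
        hammingAuto n _≟_ T t        ≡⟨ hammingAuto≡lam n gen _≟_ g t ⟩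
        lam n _≟_ g (_·_ n t α)      ≤⟨ ≤-maxOf (lam n _≟_ g) (∈-nonzeros⁺ n _≟_ tα≢0) ⟩
        maxLam n _≟_ g               ≡⟨ maxλ≡k ⟩
        k                            ∎
        where
        open ≤-Reasoning
        tα≢0 : ¬ toℕ (_·_ n t α) ≡ 0
        tα≢0 tα≡0 = <⇒≢ 0<t (sym (·-injective-on-generator n gen t<n (>-nonZero⁻¹ n)
                                  (toℕ-injective (trans tα≡0 (sym (toℕ-0· n α))))))

    k≤hammingMax : k ≤ hammingMax n _≟_ T
    k≤hammingMax with maximising-difference
    ... | β , β∈ , λβ≡k with gen β
    ... | i , iα≡β = begin
      k                                   ≡⟨ λβ≡k ⟨
      lam n _≟_ g β                       ≡⟨ cong (lam n _≟_ g) tα≡β ⟨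
      lam n _≟_ g (_·_ n (i % n) α)       ≡⟨ hammingAuto≡lam n gen _≟_ g (i % n) ⟨
      hammingAuto n _≟_ T (i % n)         ≤⟨ ≤-maxOf (hammingAuto n _≟_ T) (∈-positives⁺ 0<t (m%n<n i n)) ⟩
      hammingMax n _≟_ T                  ∎
      where
      open ≤-Reasoning
      tα≡β : _·_ n (i % n) α ≡ β
      tα≡β = trans (·-mod n i α) iα≡β
      0<t : 0 < i % n
      0<t = n≢0⇒n>0 (λ t≡0 → ∈-nonzeros⁻ n _≟_ β∈ (begin-equality
        toℕ β                   ≡⟨ cong toℕ tα≡β ⟨
        toℕ (_·_ n (i % n) α)   ≡⟨ cong (λ t → toℕ (_·_ n t α)) t≡0 ⟩
        toℕ (_·_ n 0 α)         ≡⟨ toℕ-0· n α ⟩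
        0                       ∎))

    hammingMax≡k : hammingMax n _≟_ T ≡ k
    hammingMax≡k = ≤-antisym hammingMax≤k k≤hammingMax

theorem11 : (n : ℕ) .{{_ : NonZero n}} (α : Fin n) → IsGenerator n α →
            {B : Set} (_≟_ : DecidableEquality B) (k : ℕ) → 2 ≤ k →
            (f : Fin n → B) → (∀ (b : B) → ∃ λ (x : Fin n) → f x ≡ b) →
            IsZDB n _≟_ f →
            (b₀ : B) → preimageSize n _≟_ f b₀ ≡ 1 →
            (∀ (b : B) → ¬ (b ≡ b₀) → preimageSize n _≟_ f b ≡ k) →
            (a₀ : Fin n) → f a₀ ≡ b₀ →
            (a : Fin n) → ¬ (f a₀ ≡ f a) →
            maxLam n _≟_ (redefineAt n _≟_ f a₀ a) ≡ k →
            (imageSize n _≟_ (redefineAt n _≟_ f a₀ a) * k ≡ n ∸ 1)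
            × (hammingMax n _≟_ (λ i → redefineAt n _≟_ f a₀ a (_·_ n i α))
                 ≡ fhsBound n (imageSize n _≟_ (redefineAt n _≟_ f a₀ a)))
theorem11 n α gen _≟_ k 2≤k f _ _ b₀ f⁻¹b₀ f⁻¹b a₀ fa₀≡b₀ a fa₀≢fa maxλ≡k =
  cong (_∸ 1) imageSize-redefined , (begin
    hammingMax n _≟_ _        ≡⟨ hammingMax≡k gen 0<k maxλ≡k ⟩
    k                         ≡⟨ fhsBound-one-more m k (2≤imageSize gen 0<k maxλ≡k) 0<k ⟨
    fhsBound (suc (m * k)) m  ≡⟨ cong (λ N → fhsBound N m) imageSize-redefined ⟩
    fhsBound n m              ∎)
  where
  open ≡-Reasoning
  open Redefined n _≟_ k f b₀ f⁻¹b₀ f⁻¹b a₀ fa₀≡b₀ a fa₀≢fa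
  m : ℕ
  m = imageSize n _≟_ (redefineAt n _≟_ f a₀ a)
  0<k : 0 < k
  0<k = ≤-trans (s≤s z≤n) 2≤k
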